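{- For every $n\ge 3$ there is a bijection between $\mathcal P_n$ and $\mathcal L_{n-1}$. Furthermore, $|\mathcal P_n|=\binom{n-1}{\lfloor\frac{n-1}{2}\rfloor}$.
   Context: $[n]=\{1,\dots,n\}$; $\mathfrak S_n$ is the set of permutations of $[n]$ in one-line notation. The circular peak set of $\sigma\in\mathfrak S_n$ is $CP(\sigma)=\{\sigma(i)\mid 2\le i\le n-1,\ \sigma(i-1)<\sigma(i)>\sigma(i+1)\}$; for $S\subseteq[n]$, $CP_n(S)=\{\sigma\in\mathfrak S_n\mid CP(\sigma)=S\}$, and $\mathcal P_n=\{S\subseteq[n]\mid CP_n(S)\neq\emptyset\}$. A Dyck path of semilength $k$ is a word in the letters $U$ (step $(1,1)$) and $D$ (step $(1,-1)$) of length $2k$ describing a lattice path from $(0,0)$ to $(2k,0)$ that never goes below the $x$-axis. An $m$-left factor of a Dyck path is a word $w_1\cdots w_m$ over $\{U,D\}$ such that $w_1\cdots w_mR$ is a Dyck path for some word $R$ over $\{U,D\}$; $\mathcal L_m$ denotes the set of all $m$-left factors of Dyck paths. -}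

module Defs where

open import Data.Nat using (ℕ; zero; suc; _<ᵇ_)
open import Data.Bool using (Bool; true; false; _∧_; if_then_else_)
open import Data.List using (List; []; _∷_; _++_; map)
open import Data.List.Membership.DecPropositional as MemDec using ()
open import Data.Nat.Properties using (_≟_)
open import Data.Fin using (Fin; toℕ)
open import Data.Fin.Subset using (Subset)
open import Data.Fin.Permutation using (Permutation′; _⟨$⟩ʳ_)
open import Data.Vec using (Vec; tabulate; toList)
open import Data.Vec.Functional using () renaming (toList to toListF)
open import Data.Empty using (⊥)
open import Data.Unit using (⊤)
open import Data.Product using (∃; Σ)
open import Data.Refinement using (Refinement)
open import Relation.Nullary.Decidable using (⌊_⌋)
open import Relation.Binary.PropositionalEquality using (_≡_)

open MemDec _≟_ using (_∈?_)

oneLine : ∀ {n} → Permutation′ n → List ℕ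
oneLine {n} σ = toListF (λ i → suc (toℕ (σ ⟨$⟩ʳ i)))

peakValues : List ℕ → List ℕ
peakValues (a ∷ b ∷ c ∷ rest) =
  (if (a <ᵇ b) ∧ (c <ᵇ b) then b ∷ [] else []) ++ peakValues (b ∷ c ∷ rest)
peakValues _ = []

-- CP(σ) ⊆ [n] as a subset of Fin n; the element i : Fin n stands for toℕ i + 1.
CP : ∀ {n} → Permutation′ n → Subset n
CP σ = tabulate (λ v → ⌊ suc (toℕ v) ∈? peakValues (oneLine σ) ⌋)

-- 𝒫ₙ = { S ⊆ [n] | CPₙ(S) ≠ ∅ }  (membership proof irrelevant, so this is a set)
𝒫 : ℕ → Set
𝒫 n = Refinement (Subset n) (λ S → ∃ λ (σ : Permutation′ n) → CP σ ≡ S)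

data Step : Set where
  U D : Step

DyckFrom : ℕ → List Step → Set
DyckFrom zero    []      = ⊤
DyckFrom (suc h) []      = ⊥
DyckFrom h       (U ∷ w) = DyckFrom (suc h) w
DyckFrom zero    (D ∷ w) = ⊥
DyckFrom (suc h) (D ∷ w) = DyckFrom h w

IsDyckPath : List Step → Set
IsDyckPath w = DyckFrom 0 w

IsLeftFactor : ∀ {m} → Vec Step m → Set
IsLeftFactor w = ∃ λ (R : List Step) → IsDyckPath (toList w ++ R)

ℒ : ℕ → Set
ℒ m = Refinement (Vec Step m) IsLeftFactor

-- A peak value needs a smaller neighbour on each side and two peaks are never adjacent, so
-- among the values 1, …, k of a permutation at most (k - 1) / 2 are peaks.  Hence 1 is never a
-- peak and, reading i ∈ S as a down step and i ∉ S as an up step for i = 2, …, n, the word of a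
-- peak set S never goes below the axis: it is a left factor of length n - 1.  Conversely, every
-- left factor is realized by inserting 1, 2, … in turn as the current maximum: at the end after
-- an up step, and right behind the first entry of the final increasing run after a down step,
-- where it becomes a peak.  Left factors of length m satisfy a ballot recursion whose solution
-- from height 0 is m C ⌊m/2⌋.
module Submission where

open import Defs
open import Data.Nat using (ℕ; _≤_; _∸_; _/_)
open import Data.Nat.Combinatorics using (_C_)
open import Data.Fin using (Fin)
open import Data.Product using (_×_)
open import Function.Bundles using (_⤖_)

open import Data.Nat.Properties
open import Algebra.Properties.CommutativeMonoid.Sum +-0-commutativeMonoid using (sum; sum-permute)
open import Algebra.Properties.CommutativeSemigroup +-commutativeSemigroup using (interchange)
open import Data.Bool using (Bool; true; false; _∨_)
open import Data.Empty using (⊥; ⊥-elim-irr)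
open import Data.Fin using (toℕ; fromℕ; fromℕ<; punchIn)
import Data.Fin as Fin
open import Data.Fin.Permutation using (Permutation; Permutation′; _⟨$⟩ʳ_; insert; insert-punchIn)
import Data.Fin.Permutation as Perm
open import Data.Fin.Properties using (+↔⊎; toℕ-fromℕ; toℕ-fromℕ<; toℕ<n)
open import Data.Irrelevant using ([_])
import Data.Irrelevant as Irr
open import Data.List using (List; []; _∷_; _++_; length)
import Data.List.Properties as List
open import Data.List.Membership.DecPropositional _≟_ using (_∈?_)
open import Data.List.Membership.Propositional using (_∈_)
open import Data.List.Relation.Unary.All using (All; []; _∷_)
import Data.List.Relation.Unary.All.Properties as All
open import Data.List.Relation.Unary.Any using (here; there)
open import Data.List.Relation.Unary.Linked using (Linked; []; [-]; _∷_)
open import Data.Nat using (zero; suc; _+_; _*_; z≤n; s≤s; z<s; _<_; _<ᵇ_; _≡ᵇ_; ⌊_/2⌋)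
open import Data.Nat.Combinatorics using (nCk+nC[k+1]≡[n+1]C[k+1]; k>n⇒nCk≡0)
open import Data.Nat.DivMod using (m/n≡1+[m∸n]/n)
open import Data.Product using (Σ; ∃; ∄; proj₁; proj₂)
open Data.Product using (_,_)
open import Data.Refinement using (Refinement; _,_; value-injective)
open import Data.Sum using (_⊎_; inj₁; inj₂)
open import Data.Sum.Function.Propositional using (_⊎-↔_)
open import Data.Unit using (⊤)
import Data.Vec as Vec
import Data.Vec.Properties as Vec
open import Data.Vec.Functional using () renaming (toList to toListF)
open import Function using (_∘_; _∘′_)
open import Function.Bundles using (_↔_; mk↔ₛ′)
open import Function.Construct.Composition using (_↔-∘_)
open import Function.Construct.Symmetry using (↔-sym)
open import Function.Properties.Inverse using (↔⇒⤖)
open import Relation.Binary.PropositionalEquality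
open import Relation.Nullary using (¬_; Dec; yes; no; contradiction)
open import Relation.Nullary.Decidable using (⌊_⌋; dec-true; dec-false; isYes≗does)

fromBool : Bool → ℕ
fromBool false = 0
fromBool true  = 1

fromBool-∨ : ∀ a b → fromBool (a ∨ b) ≤ fromBool a + fromBool b
fromBool-∨ false b = ≤-refl
fromBool-∨ true  b = s≤s z≤n

<ᵇ-true : ∀ {m n} → m < n → (m <ᵇ n) ≡ true
<ᵇ-true {m} {n} = dec-true (m <? n)

<ᵇ-false : ∀ {m n} → ¬ m < n → (m <ᵇ n) ≡ false
<ᵇ-false {m} {n} = dec-false (m <? n)

countTrue : ℕ → (ℕ → Bool) → ℕ
countTrue n G = sum {n} (λ i → fromBool (G (toℕ i)))

countTrue-false : ∀ n → countTrue n (λ _ → false) ≡ 0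
countTrue-false zero    = refl
countTrue-false (suc n) = countTrue-false n

countTrue-subadditive : ∀ n (F G H : ℕ → Bool) →
  (∀ x → fromBool (F x) ≤ fromBool (G x) + fromBool (H x)) →
  countTrue n F ≤ countTrue n G + countTrue n H
countTrue-subadditive zero    F G H F≤G+H = z≤n
countTrue-subadditive (suc n) F G H F≤G+H = begin
  fromBool (F 0) + countTrue n (F ∘′ suc)
    ≤⟨ +-mono-≤ (F≤G+H 0) (countTrue-subadditive n (F ∘′ suc) (G ∘′ suc) (H ∘′ suc) (F≤G+H ∘ suc)) ⟩
  (fromBool (G 0) + fromBool (H 0)) + (countTrue n (G ∘′ suc) + countTrue n (H ∘′ suc))
    ≡⟨ interchange (fromBool (G 0)) _ _ _ ⟩
  countTrue (suc n) G + countTrue (suc n) H ∎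
  where open ≤-Reasoning

countTrue-≡ᵇ : ∀ n y → countTrue n (_≡ᵇ y) ≤ fromBool (y <ᵇ n)
countTrue-≡ᵇ zero    y       = z≤n
countTrue-≡ᵇ (suc n) zero    = ≤-reflexive (cong suc (countTrue-false n))
countTrue-≡ᵇ (suc n) (suc y) = countTrue-≡ᵇ n y

countTrue-<ᵇ : ∀ n t → countTrue n (_<ᵇ t) ≤ t
countTrue-<ᵇ n       zero    = ≤-reflexive (countTrue-false n)
countTrue-<ᵇ zero    (suc t) = z≤n
countTrue-<ᵇ (suc n) (suc t) = s≤s (countTrue-<ᵇ n t)

countBelow : ℕ → List ℕ → ℕ
countBelow t []       = 0
countBelow t (x ∷ xs) = fromBool (x <ᵇ t) + countBelow t xs

countBelow-< : ∀ {t a} L → a < t → countBelow t (a ∷ L) ≡ suc (countBelow t L)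
countBelow-< L a<t rewrite <ᵇ-true a<t = refl

countBelow-≮ : ∀ {t a} L → ¬ a < t → countBelow t (a ∷ L) ≡ countBelow t L
countBelow-≮ L a≮t rewrite <ᵇ-false a≮t = refl

-- ⌊_⌋ is isYes, which unlike does is stuck on a variable decision; hence the detour.
∈?-∷ : ∀ x y P → ⌊ x ∈? y ∷ P ⌋ ≡ (x ≡ᵇ y) ∨ ⌊ x ∈? P ⌋
∈?-∷ x y P = trans (isYes≗does _) (cong ((x ≡ᵇ y) ∨_) (sym (isYes≗does _)))

∈?-∷-≤ : ∀ x y P → fromBool ⌊ x ∈? y ∷ P ⌋ ≤ fromBool (x ≡ᵇ y) + fromBool ⌊ x ∈? P ⌋
∈?-∷-≤ x y P rewrite ∈?-∷ x y P = fromBool-∨ (x ≡ᵇ y) ⌊ x ∈? P ⌋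

countTrue-∈-≤-countBelow : ∀ n P → countTrue n (λ x → ⌊ x ∈? P ⌋) ≤ countBelow n P
countTrue-∈-≤-countBelow n []      = ≤-reflexive (countTrue-false n)
countTrue-∈-≤-countBelow n (y ∷ P) = begin
  countTrue n (λ x → ⌊ x ∈? y ∷ P ⌋)
    ≤⟨ countTrue-subadditive n _ (_≡ᵇ y) (λ x → ⌊ x ∈? P ⌋) (λ x → ∈?-∷-≤ x y P) ⟩
  countTrue n (_≡ᵇ y) + countTrue n (λ x → ⌊ x ∈? P ⌋)
    ≤⟨ +-mono-≤ (countTrue-≡ᵇ n y) (countTrue-∈-≤-countBelow n P) ⟩
  countBelow n (y ∷ P) ∎
  where open ≤-Reasoning

countBelow-toList : ∀ {n} t (f : Fin n → ℕ) → countBelow t (toListF f) ≡ sum (λ i → fromBool (f i <ᵇ t))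
countBelow-toList {zero}  t f = refl
countBelow-toList {suc n} t f = cong (fromBool (f Fin.zero <ᵇ t) +_) (countBelow-toList t (f ∘′ Fin.suc))

-- the one-line notation takes each value 1, …, t at most once
countBelow-oneLine : ∀ {n} (σ : Permutation′ n) t → countBelow (suc t) (oneLine σ) ≤ t
countBelow-oneLine {n} σ t = begin
  countBelow (suc t) (oneLine σ)        ≡⟨ countBelow-toList (suc t) (λ i → suc (toℕ (σ ⟨$⟩ʳ i))) ⟩
  sum (λ i → below (σ ⟨$⟩ʳ i))           ≡⟨ sum-permute below σ ⟨
  countTrue n (_<ᵇ t)                   ≤⟨ countTrue-<ᵇ n t ⟩
  t                                     ∎
  where
  open ≤-Reasoning
  below : Fin n → ℕ
  below j = fromBool (toℕ j <ᵇ t)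

-- Peaks are sparse

peakValues-descent : ∀ {b c} r → c < b → peakValues (b ∷ c ∷ r) ≡ peakValues (c ∷ r)
peakValues-descent []      c<b = refl
peakValues-descent (d ∷ r) c<b rewrite <ᵇ-false (<⇒≯ c<b) = refl

peakValues-peak : ∀ {a b c} r → a < b → c < b → peakValues (a ∷ b ∷ c ∷ r) ≡ b ∷ peakValues (c ∷ r)
peakValues-peak r a<b c<b rewrite <ᵇ-true a<b | <ᵇ-true c<b = cong (_ ∷_) (peakValues-descent r c<b)

peakValues-no-peak : ∀ {a b c} r → ¬ (a < b × c < b) → peakValues (a ∷ b ∷ c ∷ r) ≡ peakValues (b ∷ c ∷ r)
peakValues-no-peak {a} {b} {c} r ¬peak with a <? b | c <? b
... | yes a<b | yes c<b = contradiction (a<b , c<b) ¬peak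
... | yes a<b | no c≮b  rewrite <ᵇ-true a<b | <ᵇ-false c≮b = refl
... | no a≮b  | _       rewrite <ᵇ-false a≮b = refl

peaksBelow : ℕ → List ℕ → ℕ
peaksBelow t L = countBelow t (peakValues L)

data PeakStep (t a b c : ℕ) (r : List ℕ) : Set where
  peak-below    : a < b → c < b → b < t →
                  peaksBelow t (a ∷ b ∷ c ∷ r) ≡ suc (peaksBelow t (c ∷ r)) → PeakStep t a b c r
  no-peak-below : peaksBelow t (a ∷ b ∷ c ∷ r) ≡ peaksBelow t (b ∷ c ∷ r) → PeakStep t a b c r

peakStep : ∀ t a b c r → PeakStep t a b c r
peakStep t a b c r with a <? b | c <? b
... | no a≮b | _ = no-peak-below (cong (countBelow t) (peakValues-no-peak r (λ (a<b , _) → a≮b a<b)))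
... | yes _  | no c≮b = no-peak-below (cong (countBelow t) (peakValues-no-peak r (λ (_ , c<b) → c≮b c<b)))
... | yes a<b | yes c<b with b <? t | cong (countBelow t) (peakValues-peak r a<b c<b)
...   | yes b<t | b-peak = peak-below a<b c<b b<t (trans b-peak (countBelow-< (peakValues (c ∷ r)) b<t))
...   | no b≮t  | b-peak = no-peak-below
  (trans b-peak (trans (countBelow-≮ (peakValues (c ∷ r)) b≮t) (cong (countBelow t) (sym (peakValues-descent r c<b)))))

-- Each peak below t has its right neighbour below t, and no two peaks are adjacent.
2*peaksBelow≤countBelow-tail : ∀ t a r → 2 * peaksBelow t (a ∷ r) ≤ countBelow t r
2*peaksBelow≤countBelow-tail t a []          = z≤n
2*peaksBelow≤countBelow-tail t a (b ∷ [])    = z≤n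
2*peaksBelow≤countBelow-tail t a (b ∷ c ∷ r) =
  extend (peakStep t a b c r) (2*peaksBelow≤countBelow-tail t c r) (2*peaksBelow≤countBelow-tail t b (c ∷ r))
  where
  open ≤-Reasoning
  extend : PeakStep t a b c r →
           2 * peaksBelow t (c ∷ r) ≤ countBelow t r →
           2 * peaksBelow t (b ∷ c ∷ r) ≤ countBelow t (c ∷ r) →
           2 * peaksBelow t (a ∷ b ∷ c ∷ r) ≤ countBelow t (b ∷ c ∷ r)
  extend (peak-below _ c<b b<t e) ih _ = begin
    2 * peaksBelow t (a ∷ b ∷ c ∷ r)  ≡⟨ cong (2 *_) e ⟩
    2 * suc (peaksBelow t (c ∷ r))    ≡⟨ *-suc 2 _ ⟩
    2 + 2 * peaksBelow t (c ∷ r)      ≤⟨ +-monoʳ-≤ 2 ih ⟩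
    2 + countBelow t r                ≡⟨ cong suc (countBelow-< r (<-trans c<b b<t)) ⟨
    suc (countBelow t (c ∷ r))        ≡⟨ countBelow-< (c ∷ r) b<t ⟨
    countBelow t (b ∷ c ∷ r)          ∎
  extend (no-peak-below e) _ ih = begin
    2 * peaksBelow t (a ∷ b ∷ c ∷ r)  ≡⟨ cong (2 *_) e ⟩
    2 * peaksBelow t (b ∷ c ∷ r)      ≤⟨ ih ⟩
    countBelow t (c ∷ r)              ≤⟨ m≤n+m _ (fromBool (b <ᵇ t)) ⟩
    countBelow t (b ∷ c ∷ r)          ∎

-- The leftmost peak below t also has its left neighbour below t.
peaksBelow-sparse : ∀ t L → peaksBelow t L ≡ 0 ⊎ suc (2 * peaksBelow t L) ≤ countBelow t L
peaksBelow-sparse t []              = inj₁ refl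
peaksBelow-sparse t (a ∷ [])        = inj₁ refl
peaksBelow-sparse t (a ∷ b ∷ [])    = inj₁ refl
peaksBelow-sparse t (a ∷ b ∷ c ∷ r) = extend (a <? t) (peakStep t a b c r) (peaksBelow-sparse t (b ∷ c ∷ r))
  where
  L = a ∷ b ∷ c ∷ r
  extend : Dec (a < t) → PeakStep t a b c r →
           peaksBelow t (b ∷ c ∷ r) ≡ 0 ⊎ suc (2 * peaksBelow t (b ∷ c ∷ r)) ≤ countBelow t (b ∷ c ∷ r) →
           peaksBelow t L ≡ 0 ⊎ suc (2 * peaksBelow t L) ≤ countBelow t L
  extend (yes a<t) _ _ =
    inj₂ (subst (suc (2 * peaksBelow t L) ≤_) (sym (countBelow-< (b ∷ c ∷ r) a<t))
                (s≤s (2*peaksBelow≤countBelow-tail t a (b ∷ c ∷ r))))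
  extend (no a≮t) (peak-below a<b _ b<t _) _ = contradiction (<-trans a<b b<t) a≮t
  extend (no a≮t) (no-peak-below e) ih rewrite e | countBelow-≮ (b ∷ c ∷ r) a≮t = ih

2*peaksBelow-oneLine : ∀ {n} (σ : Permutation′ n) j → 2 * peaksBelow (2 + j) (oneLine σ) ≤ j
2*peaksBelow-oneLine σ j with peaksBelow-sparse (2 + j) (oneLine σ)
... | inj₁ none  rewrite none = z≤n
... | inj₂ sparse = ≤-pred (≤-trans sparse (countBelow-oneLine σ (suc j)))

-- Peak sets give left factors

Nonneg : ℕ → List Step → Set
Nonneg h       []      = ⊤
Nonneg h       (U ∷ w) = Nonneg (suc h) w
Nonneg zero    (D ∷ w) = ⊥
Nonneg (suc h) (D ∷ w) = Nonneg h w

stepOf : Bool → Step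
stepOf true  = D
stepOf false = U

Nonneg-fromCounts : ∀ {k} (G : ℕ → Bool) h → (∀ j → 2 * countTrue j G ≤ h + j) →
                    Nonneg h (Vec.toList (Vec.map stepOf (Vec.tabulate {n = k} (G ∘ toℕ))))
Nonneg-fromCounts {zero}  G h       bound = _
Nonneg-fromCounts {suc k} G h       bound with G 0 | bound ∘ suc
... | false | bound′ = Nonneg-fromCounts {k} (G ∘ suc) (suc h) λ j →
  subst (2 * countTrue j (G ∘ suc) ≤_) (+-suc h j) (bound′ j)
Nonneg-fromCounts {suc k} G zero    bound | true | bound′ = contradiction (bound′ 0) λ { (s≤s ()) }
Nonneg-fromCounts {suc k} G (suc h) bound | true | bound′ = Nonneg-fromCounts {k} (G ∘ suc) h λ j →
  ≤-pred (≤-pred (subst₂ _≤_ (*-suc 2 (countTrue j (G ∘ suc))) (cong suc (+-suc h j)) (bound′ j)))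

toWord : ∀ {m} → Vec.Vec Bool (suc m) → Vec.Vec Step m
toWord S = Vec.map stepOf (Vec.tail S)

module _ {m} (σ : Permutation′ (suc m)) where

  private
    isPeak : ℕ → Bool
    isPeak x = ⌊ x ∈? peakValues (oneLine σ) ⌋

    2*countPeaks≤ : ∀ j → 2 * countTrue (2 + j) isPeak ≤ j
    2*countPeaks≤ j = ≤-trans (*-monoʳ-≤ 2 (countTrue-∈-≤-countBelow (2 + j) (peakValues (oneLine σ))))
                              (2*peaksBelow-oneLine σ j)

  CP-head : Vec.head (CP σ) ≡ false
  CP-head with isPeak 1 | 2*countPeaks≤ 0
  ... | false | _     = refl
  ... | true  | bound = contradiction (≤-trans (m≤n+m 1 (fromBool (isPeak 0))) (≤-trans (m≤n*m _ 2) bound)) λ ()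

  Nonneg-CP : Nonneg 0 (Vec.toList (toWord (CP σ)))
  Nonneg-CP = Nonneg-fromCounts {m} (isPeak ∘ suc ∘ suc) 0 λ j →
    ≤-trans (*-monoʳ-≤ 2 (≤-trans (m≤n+m _ (fromBool (isPeak 1))) (m≤n+m _ (fromBool (isPeak 0)))))
            (2*countPeaks≤ j)

-- Realizing a left factor by inserting maxima

insertAt : ∀ {A : Set} → ℕ → A → List A → List A
insertAt zero    x ys       = x ∷ ys
insertAt (suc i) x []       = x ∷ []
insertAt (suc i) x (y ∷ ys) = y ∷ insertAt i x ys

insertAt-length : ∀ {A : Set} (x : A) ys → insertAt (length ys) x ys ≡ ys ++ x ∷ []
insertAt-length x []       = refl
insertAt-length x (y ∷ ys) = cong (y ∷_) (insertAt-length x ys)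

toListF-punchIn : ∀ {A : Set} {k} (i : Fin (suc k)) (g : Fin (suc k) → A) →
                  toListF g ≡ insertAt (toℕ i) (g i) (toListF (g ∘ punchIn i))
toListF-punchIn             Fin.zero    g = refl
toListF-punchIn {k = suc k} (Fin.suc i) g = cong (g Fin.zero ∷_) (toListF-punchIn i (g ∘ Fin.suc))

insert-self : ∀ {m n} (i : Fin (suc m)) (j : Fin (suc n)) (π : Permutation m n) → insert i j π ⟨$⟩ʳ i ≡ j
insert-self i j π with i Fin.≟ i
... | yes _  = refl
... | no i≢i = contradiction refl i≢i

toℕ-punchIn-fromℕ : ∀ {k} (j : Fin k) → toℕ (punchIn (fromℕ k) j) ≡ toℕ j
toℕ-punchIn-fromℕ Fin.zero    = refl
toℕ-punchIn-fromℕ (Fin.suc j) = cong suc (toℕ-punchIn-fromℕ j)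

oneLine-insert-max : ∀ {k} (i : Fin (suc k)) (σ : Permutation′ k) →
                     oneLine (insert i (fromℕ k) σ) ≡ insertAt (toℕ i) (suc k) (oneLine σ)
oneLine-insert-max {k} i σ = begin
  oneLine τ
    ≡⟨ toListF-punchIn i (λ c → suc (toℕ (τ ⟨$⟩ʳ c))) ⟩
  insertAt (toℕ i) (suc (toℕ (τ ⟨$⟩ʳ i))) (toListF λ c → suc (toℕ (τ ⟨$⟩ʳ punchIn i c)))
    ≡⟨ cong₂ (insertAt (toℕ i)) (cong suc (trans (cong toℕ (insert-self i (fromℕ k) σ)) (toℕ-fromℕ k)))
                                (List.tabulate-cong λ c → cong suc (trans (cong toℕ (insert-punchIn i (fromℕ k) σ c))
                                                                          (toℕ-punchIn-fromℕ _))) ⟩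
  insertAt (toℕ i) (suc k) (oneLine σ) ∎
  where
  open ≡-Reasoning
  τ = insert i (fromℕ k) σ

length-oneLine : ∀ {k} (σ : Permutation′ k) → length (oneLine σ) ≡ k
length-oneLine σ = List.length-tabulate _

oneLine-< : ∀ {k} (σ : Permutation′ k) → All (_< suc k) (oneLine σ)
oneLine-< σ = All.tabulate⁺ λ i → s≤s (toℕ<n (σ ⟨$⟩ʳ i))

-- Zigzag ps W: W = a₁ p₁ a₂ p₂ … aₖ pₖ followed by an increasing run,
-- with aᵢ < pᵢ > aᵢ₊₁ and ps = p₁ … pₖ.
data Zigzag : List ℕ → List ℕ → Set where
  run  : ∀ {W} → Linked _<_ W → Zigzag [] W
  peak : ∀ {a b c ps W} → a < b → c < b → Zigzag ps (c ∷ W) → Zigzag (b ∷ ps) (a ∷ b ∷ c ∷ W)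

peakValues-increasing : ∀ {W} → Linked _<_ W → peakValues W ≡ []
peakValues-increasing []                     = refl
peakValues-increasing [-]                    = refl
peakValues-increasing (_ ∷ [-])              = refl
peakValues-increasing (_ ∷ inc@(_∷_ {xs = r} y<z _)) =
  trans (peakValues-no-peak r λ (_ , z<y) → <-asym y<z z<y) (peakValues-increasing inc)

peakValues-zigzag : ∀ {ps W} → Zigzag ps W → peakValues W ≡ ps
peakValues-zigzag (run inc)              = peakValues-increasing inc
peakValues-zigzag (peak {W = W} a<b c<b z) = trans (peakValues-peak W a<b c<b) (cong (_ ∷_) (peakValues-zigzag z))

Linked-snoc : ∀ {W M} → Linked _<_ W → All (_< M) W → Linked _<_ (W ++ M ∷ [])
Linked-snoc []        []           = [-]
Linked-snoc [-]       (x<M ∷ [])   = x<M ∷ [-]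
Linked-snoc (x<y ∷ r) (_ ∷ r<M)    = x<y ∷ Linked-snoc r r<M

zigzag-snoc : ∀ {ps W M} → Zigzag ps W → All (_< M) W → Zigzag ps (W ++ M ∷ [])
zigzag-snoc (run inc)        W<M             = run (Linked-snoc inc W<M)
zigzag-snoc (peak a<b c<b z) (_ ∷ _ ∷ W<M)   = peak a<b c<b (zigzag-snoc z W<M)

-- the position at which inserting a new maximum creates the next peak
peakSlot : List ℕ → ℕ
peakSlot ps = suc (twiceLength ps)
  where
  twiceLength : List ℕ → ℕ
  twiceLength []       = 0
  twiceLength (_ ∷ ps) = suc (suc (twiceLength ps))

peakSlot-snoc : ∀ ps x → peakSlot (ps ++ x ∷ []) ≡ suc (suc (peakSlot ps))
peakSlot-snoc []       x = refl
peakSlot-snoc (_ ∷ ps) x = cong (suc ∘ suc) (peakSlot-snoc ps x)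

zigzag-insert : ∀ {ps W M} → Zigzag ps W → peakSlot ps < length W → All (_< M) W →
                Zigzag (ps ++ M ∷ []) (insertAt (peakSlot ps) M W)
zigzag-insert (run (x<y ∷ inc))  _                (x<M ∷ y<M ∷ _) = peak x<M y<M (run inc)
zigzag-insert (run [-])          (s≤s ())         _
zigzag-insert (peak a<b c<b z)   (s≤s (s≤s slot<)) (_ ∷ _ ∷ W<M)  = peak a<b c<b (zigzag-insert z slot< W<M)

downValues : ℕ → List Step → List ℕ
downValues a []      = []
downValues a (U ∷ w) = downValues (suc a) w
downValues a (D ∷ w) = a ∷ downValues (suc a) w

-- Invariant: the final increasing run of oneLine σ has h + 1 entries.
realize : ∀ w h {k} (σ : Permutation′ k) ps {N} → length w + k ≡ N →
          Zigzag ps (oneLine σ) → k ≡ h + peakSlot ps → Nonneg h w →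
          Σ (Permutation′ N) λ τ → peakValues (oneLine τ) ≡ ps ++ downValues (suc k) w
realize [] h σ ps refl zig _ _ = σ , trans (peakValues-zigzag zig) (sym (List.++-identityʳ ps))
realize (U ∷ w) h {k} σ ps size zig k≡ nonneg =
  realize w (suc h) (insert (fromℕ k) (fromℕ k) σ) ps (trans (+-suc (length w) k) size) zig′ (cong suc k≡) nonneg
  where
  appended : oneLine (insert (fromℕ k) (fromℕ k) σ) ≡ oneLine σ ++ suc k ∷ []
  appended = begin
    oneLine (insert (fromℕ k) (fromℕ k) σ)                  ≡⟨ oneLine-insert-max (fromℕ k) σ ⟩
    insertAt (toℕ (fromℕ k)) (suc k) (oneLine σ)            ≡⟨ cong (λ i → insertAt i (suc k) (oneLine σ))
                                                                     (trans (toℕ-fromℕ k) (sym (length-oneLine σ))) ⟩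
    insertAt (length (oneLine σ)) (suc k) (oneLine σ)       ≡⟨ insertAt-length (suc k) (oneLine σ) ⟩
    oneLine σ ++ suc k ∷ []                                 ∎
    where open ≡-Reasoning
  zig′ : Zigzag ps (oneLine (insert (fromℕ k) (fromℕ k) σ))
  zig′ = subst (Zigzag ps) (sym appended) (zigzag-snoc zig (oneLine-< σ))
realize (D ∷ w) zero    _ _ _ _ _ ()
realize (D ∷ w) (suc h) {k} σ ps size zig k≡ nonneg =
  proj₁ rest , trans (proj₂ rest) (List.++-assoc ps (suc k ∷ []) (downValues (suc (suc k)) w))
  where
  slot<k : peakSlot ps < k
  slot<k = subst (peakSlot ps <_) (sym k≡) (s≤s (m≤n+m (peakSlot ps) h))
  slot = fromℕ< (m<n⇒m<1+n slot<k)
  inserted : oneLine (insert slot (fromℕ k) σ) ≡ insertAt (peakSlot ps) (suc k) (oneLine σ)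
  inserted = trans (oneLine-insert-max slot σ)
                   (cong (λ i → insertAt i (suc k) (oneLine σ)) (toℕ-fromℕ< (m<n⇒m<1+n slot<k)))
  zig′ : Zigzag (ps ++ suc k ∷ []) (oneLine (insert slot (fromℕ k) σ))
  zig′ = subst (Zigzag (ps ++ suc k ∷ [])) (sym inserted)
               (zigzag-insert zig (subst (peakSlot ps <_) (sym (length-oneLine σ)) slot<k) (oneLine-< σ))
  k′≡ : suc k ≡ h + peakSlot (ps ++ suc k ∷ [])
  k′≡ = begin
    suc k                                 ≡⟨ cong suc k≡ ⟩
    suc (suc (h + peakSlot ps))           ≡⟨ cong suc (+-suc h (peakSlot ps)) ⟨
    suc (h + suc (peakSlot ps))           ≡⟨ +-suc h (suc (peakSlot ps)) ⟨
    h + suc (suc (peakSlot ps))           ≡⟨ cong (h +_) (peakSlot-snoc ps (suc k)) ⟨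
    h + peakSlot (ps ++ suc k ∷ [])       ∎
    where open ≡-Reasoning
  rest = realize w h (insert slot (fromℕ k) σ) (ps ++ suc k ∷ []) (trans (+-suc (length w) k) size) zig′ k′≡ nonneg

isDown : Step → Bool
isDown U = false
isDown D = true

downValues-≥ : ∀ {x} a w → x ∈ downValues a w → a ≤ x
downValues-≥ a (U ∷ w) x∈       = ≤-trans (n≤1+n a) (downValues-≥ (suc a) w x∈)
downValues-≥ a (D ∷ w) (here refl) = ≤-refl
downValues-≥ a (D ∷ w) (there x∈) = ≤-trans (n≤1+n a) (downValues-≥ (suc a) w x∈)

∉-downValues : ∀ {x} a w → x < a → ⌊ x ∈? downValues a w ⌋ ≡ false
∉-downValues {x} a w x<a =
  trans (isYes≗does _) (dec-false (x ∈? downValues a w) λ x∈ → <⇒≱ x<a (downValues-≥ a w x∈))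

∈?-downValues : ∀ {k} a (w : Vec.Vec Step k) (v : Fin k) →
                ⌊ a + toℕ v ∈? downValues a (Vec.toList w) ⌋ ≡ isDown (Vec.lookup w v)
∈?-downValues a (U Vec.∷ w) Fin.zero    = ∉-downValues (suc a) (Vec.toList w) (≤-reflexive (cong suc (+-identityʳ a)))
∈?-downValues a (D Vec.∷ w) Fin.zero    =
  trans (isYes≗does _) (dec-true (a + 0 ∈? a ∷ downValues (suc a) (Vec.toList w)) (here (+-identityʳ a)))
∈?-downValues a (U Vec.∷ w) (Fin.suc v) rewrite +-suc a (toℕ v) = ∈?-downValues (suc a) w v
∈?-downValues a (D Vec.∷ w) (Fin.suc v) rewrite ∈?-∷ (a + suc (toℕ v)) a (downValues (suc a) (Vec.toList w))
                                              | dec-false (a + suc (toℕ v) ≟ a) (m+1+n≢m a)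
                                              | +-suc a (toℕ v) = ∈?-downValues (suc a) w v

CP-realize : ∀ {m} (w : Vec.Vec Step m) → Nonneg 0 (Vec.toList w) →
             ∃ λ (τ : Permutation′ (suc m)) → CP τ ≡ false Vec.∷ Vec.map isDown w
CP-realize {m} w nonneg = τ , (begin
  CP τ
    ≡⟨ Vec.tabulate-cong (λ v → cong (λ P → ⌊ suc (toℕ v) ∈? P ⌋) peaks) ⟩
  Vec.tabulate (λ v → ⌊ suc (toℕ v) ∈? downValues 2 (Vec.toList w) ⌋)
    ≡⟨ cong₂ Vec._∷_ (∉-downValues 2 (Vec.toList w) (s≤s (s≤s z≤n)))
                     (Vec.tabulate-cong (∈?-downValues 2 w)) ⟩
  false Vec.∷ Vec.tabulate (isDown ∘ Vec.lookup w)
    ≡⟨ cong (false Vec.∷_) (trans (Vec.tabulate-∘ isDown (Vec.lookup w))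
                                  (cong (Vec.map isDown) (Vec.tabulate∘lookup w))) ⟩
  false Vec.∷ Vec.map isDown w ∎)
  where
  open ≡-Reasoning
  built = realize (Vec.toList w) 0 Perm.id [] (trans (+-comm _ 1) (cong suc (Vec.length-toList w))) (run [-]) refl nonneg
  τ = proj₁ built
  peaks : peakValues (oneLine τ) ≡ downValues 2 (Vec.toList w)
  peaks = proj₂ built

descent : ℕ → List Step
descent zero    = []
descent (suc h) = D ∷ descent h

DyckFrom-descent : ∀ h → DyckFrom h (descent h)
DyckFrom-descent zero    = _
DyckFrom-descent (suc h) = DyckFrom-descent h

Nonneg⇒completable : ∀ h w → Nonneg h w → ∃ λ R → DyckFrom h (w ++ R)
Nonneg⇒completable h       []      _  = descent h , DyckFrom-descent h
Nonneg⇒completable zero    (U ∷ w) nn = Nonneg⇒completable 1 w nn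
Nonneg⇒completable (suc h) (U ∷ w) nn = Nonneg⇒completable (suc (suc h)) w nn
Nonneg⇒completable (suc h) (D ∷ w) nn = Nonneg⇒completable h w nn

completable⇒Nonneg : ∀ h w R → DyckFrom h (w ++ R) → Nonneg h w
completable⇒Nonneg h       []      R _ = _
completable⇒Nonneg zero    (U ∷ w) R d = completable⇒Nonneg 1 w R d
completable⇒Nonneg (suc h) (U ∷ w) R d = completable⇒Nonneg (suc (suc h)) w R d
completable⇒Nonneg (suc h) (D ∷ w) R d = completable⇒Nonneg h w R d

LeftFactors : ℕ → ℕ → Set
LeftFactors m h = Refinement (Vec.Vec Step m) (Nonneg h ∘ Vec.toList)

ℒ↔LeftFactors : ∀ m → ℒ m ↔ LeftFactors m 0
ℒ↔LeftFactors m = mk↔ₛ′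
  (λ (w , p) → w , Irr.map (λ (R , d) → completable⇒Nonneg 0 (Vec.toList w) R d) p)
  (λ (w , p) → w , Irr.map (Nonneg⇒completable 0 (Vec.toList w)) p)
  (λ _ → refl) (λ _ → refl)

stepOf-isDown : ∀ s → stepOf (isDown s) ≡ s
stepOf-isDown U = refl
stepOf-isDown D = refl

isDown-stepOf : ∀ b → isDown (stepOf b) ≡ b
isDown-stepOf false = refl
isDown-stepOf true  = refl

map-inverse : ∀ {A B : Set} {f : A → B} {g : B → A} → (∀ x → g (f x) ≡ x) →
              ∀ {n} (xs : Vec.Vec A n) → Vec.map g (Vec.map f xs) ≡ xs
map-inverse {f = f} {g} gf xs = trans (sym (Vec.map-∘ g f xs)) (trans (Vec.map-cong gf xs) (Vec.map-id xs))

𝒫↔LeftFactors : ∀ m → 𝒫 (suc m) ↔ LeftFactors m 0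
𝒫↔LeftFactors m = mk↔ₛ′ to from (λ (w , _) → value-injective (map-inverse stepOf-isDown w)) from∘to
  where
  to : 𝒫 (suc m) → LeftFactors m 0
  to (S , p) = toWord S , Irr.map (λ (σ , CPσ≡S) → subst (Nonneg 0 ∘ Vec.toList ∘ toWord) CPσ≡S (Nonneg-CP σ)) p
  from : LeftFactors m 0 → 𝒫 (suc m)
  from (w , p) = false Vec.∷ Vec.map isDown w , Irr.map (CP-realize w) p
  from∘to : ∀ S → from (to S) ≡ S
  from∘to (false Vec.∷ bs , _) = value-injective (cong (false Vec.∷_) (map-inverse isDown-stepOf bs))
  from∘to (true  Vec.∷ bs , [ realized ]) = ⊥-elim-irr (head-true realized)
    where
    head-true : ∄ λ σ → CP σ ≡ true Vec.∷ bs
    head-true (σ , CPσ≡S) with () ← trans (cong Vec.head (sym CPσ≡S)) (CP-head σ)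

-- Counting left factors

LeftFactors-ground : ∀ m → LeftFactors (suc m) 0 ↔ LeftFactors m 1
LeftFactors-ground m = mk↔ₛ′ to from (λ _ → refl) from∘to
  where
  to : LeftFactors (suc m) 0 → LeftFactors m 1
  to (U Vec.∷ w , p)       = w , p
  to (D Vec.∷ w , [ () ])
  from : LeftFactors m 1 → LeftFactors (suc m) 0
  from (w , p) = U Vec.∷ w , p
  from∘to : ∀ w → from (to w) ≡ w
  from∘to (U Vec.∷ w , p)      = refl
  from∘to (D Vec.∷ w , [ () ])

LeftFactors-split : ∀ m h → LeftFactors (suc m) (suc h) ↔ (LeftFactors m (suc (suc h)) ⊎ LeftFactors m h)
LeftFactors-split m h = mk↔ₛ′ to from to∘from from∘to
  where
  to : LeftFactors (suc m) (suc h) → LeftFactors m (suc (suc h)) ⊎ LeftFactors m h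
  to (U Vec.∷ w , p) = inj₁ (w , p)
  to (D Vec.∷ w , p) = inj₂ (w , p)
  from : LeftFactors m (suc (suc h)) ⊎ LeftFactors m h → LeftFactors (suc m) (suc h)
  from (inj₁ (w , p)) = U Vec.∷ w , p
  from (inj₂ (w , p)) = D Vec.∷ w , p
  to∘from : ∀ x → to (from x) ≡ x
  to∘from (inj₁ _) = refl
  to∘from (inj₂ _) = refl
  from∘to : ∀ x → from (to x) ≡ x
  from∘to (U Vec.∷ w , p) = refl
  from∘to (D Vec.∷ w , p) = refl

leftFactorCount : ℕ → ℕ → ℕ
leftFactorCount zero    h       = 1
leftFactorCount (suc m) zero    = leftFactorCount m 1
leftFactorCount (suc m) (suc h) = leftFactorCount m (suc (suc h)) + leftFactorCount m h

LeftFactors↔Fin : ∀ m h → LeftFactors m h ↔ Fin (leftFactorCount m h)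
LeftFactors↔Fin zero    h       =
  mk↔ₛ′ (λ _ → Fin.zero) (λ _ → Vec.[] , [ _ ]) (λ { Fin.zero → refl ; (Fin.suc ()) }) (λ { (Vec.[] , _) → refl })
LeftFactors↔Fin (suc m) zero    = LeftFactors↔Fin m 1 ↔-∘ LeftFactors-ground m
LeftFactors↔Fin (suc m) (suc h) =
  ↔-sym +↔⊎ ↔-∘ ((LeftFactors↔Fin m (suc (suc h)) ⊎-↔ LeftFactors↔Fin m h) ↔-∘ LeftFactors-split m h)

window : ℕ → ℕ → ℕ → ℕ
window m lo zero    = 0
window m lo (suc k) = m C lo + window m (suc lo) k

window-zero-row : ∀ lo k → window 0 (suc lo) k ≡ 0
window-zero-row lo zero    = refl
window-zero-row lo (suc k) = cong₂ _+_ (k>n⇒nCk≡0 {0} {suc lo} z<s) (window-zero-row (suc lo) k)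

window-snoc : ∀ m lo k → window m lo (suc k) ≡ window m lo k + m C (lo + k)
window-snoc m lo zero    = trans (+-identityʳ (m C lo)) (cong (m C_) (sym (+-identityʳ lo)))
window-snoc m lo (suc k) = begin
  m C lo + window m (suc lo) (suc k)             ≡⟨ cong (m C lo +_) (window-snoc m (suc lo) k) ⟩
  m C lo + (window m (suc lo) k + m C (suc lo + k)) ≡⟨ +-assoc (m C lo) _ _ ⟨
  window m lo (suc k) + m C (suc lo + k)         ≡⟨ cong (λ i → window m lo (suc k) + m C i) (+-suc lo k) ⟨
  window m lo (suc k) + m C (lo + suc k)         ∎
  where open ≡-Reasoning

window-pascal : ∀ m lo k → window (suc m) (suc lo) k ≡ window m (suc lo) k + window m lo k
window-pascal m lo zero    = refl
window-pascal m lo (suc k) = begin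
  suc m C suc lo + window (suc m) (suc (suc lo)) k
    ≡⟨ cong₂ _+_ (nCk+nC[k+1]≡[n+1]C[k+1] m lo) (sym (window-pascal m (suc lo) k)) ⟨
  (m C lo + m C suc lo) + (window m (suc (suc lo)) k + window m (suc lo) k)
    ≡⟨ cong (_+ (window m (suc (suc lo)) k + window m (suc lo) k)) (+-comm (m C lo) _) ⟩
  (m C suc lo + m C lo) + (window m (suc (suc lo)) k + window m (suc lo) k)
    ≡⟨ interchange (m C suc lo) _ _ _ ⟩
  window m (suc lo) (suc k) + window m lo (suc k) ∎
  where open ≡-Reasoning

window-pascal₀ : ∀ m k → window (suc m) 0 (suc k) ≡ window m 0 (suc k) + window m 0 k
window-pascal₀ m k = cong suc (window-pascal m 0 k)

window-recurrence : ∀ m a k → window m a (2 + k) + window m (suc a) k ≡ window (suc m) (suc a) (suc k)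
window-recurrence m a k = begin
  (m C a + window m (suc a) (suc k)) + window m (suc a) k   ≡⟨ cong (_+ window m (suc a) k) (+-comm (m C a) _) ⟩
  (window m (suc a) (suc k) + m C a) + window m (suc a) k   ≡⟨ +-assoc (window m (suc a) (suc k)) _ _ ⟩
  window m (suc a) (suc k) + window m a (suc k)             ≡⟨ window-pascal m a (suc k) ⟨
  window (suc m) (suc a) (suc k)                            ∎
  where open ≡-Reasoning

window-recurrence₀ : ∀ m k → m < suc k → window m 0 (2 + k) + window m 0 k ≡ window (suc m) 0 (suc k)
window-recurrence₀ m k m<1+k = begin
  window m 0 (2 + k) + window m 0 k                 ≡⟨ cong (_+ window m 0 k) (window-snoc m 0 (suc k)) ⟩
  window m 0 (suc k) + m C suc k + window m 0 k     ≡⟨ cong (λ c → window m 0 (suc k) + c + window m 0 k) (k>n⇒nCk≡0 m<1+k) ⟩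
  window m 0 (suc k) + 0 + window m 0 k             ≡⟨ cong (_+ window m 0 k) (+-identityʳ (window m 0 (suc k))) ⟩
  window m 0 (suc k) + window m 0 k                 ≡⟨ window-pascal₀ m k ⟨
  window (suc m) 0 (suc k)                          ∎
  where open ≡-Reasoning

∸-suc-suc : ∀ m h → 2 + h ≤ m → m ∸ h ≡ 2 + (m ∸ (2 + h))
∸-suc-suc (suc (suc m)) zero    _           = refl
∸-suc-suc (suc m)       (suc h) (s≤s 2+h≤m) = ∸-suc-suc m h 2+h≤m

⌊∸/2⌋≡0 : ∀ m h → m ≤ suc h → ⌊ m ∸ h /2⌋ ≡ 0
⌊∸/2⌋≡0 zero          h       _           = cong ⌊_/2⌋ (0∸n≡0 h)
⌊∸/2⌋≡0 (suc zero)    zero    _           = refl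
⌊∸/2⌋≡0 (suc (suc m)) zero    (s≤s ())
⌊∸/2⌋≡0 (suc m)       (suc h) (s≤s m≤h+1) = ⌊∸/2⌋≡0 m h m≤h+1

-- The reflection principle's count: h + 1 consecutive binomials centred at (m - h) / 2.
leftFactorCount-window : ∀ m h → leftFactorCount m h ≡ window m ⌊ m ∸ h /2⌋ (suc h)
leftFactorCount-window zero          h    rewrite 0∸n≡0 h = sym (cong suc (window-zero-row 0 h))
leftFactorCount-window (suc zero)    zero = refl
leftFactorCount-window (suc (suc m)) zero =
  trans (trans (leftFactorCount-window (suc m) 1) (sym (+-identityʳ _))) (window-recurrence (suc m) ⌊ m /2⌋ 0)
leftFactorCount-window (suc m) (suc h) with 2 + h ≤? m
... | yes 2+h≤m rewrite ∸-suc-suc m h 2+h≤m =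
  trans (cong₂ _+_ (leftFactorCount-window m (2 + h))
                   (trans (leftFactorCount-window m h) (cong (λ i → window m ⌊ i /2⌋ (suc h)) (∸-suc-suc m h 2+h≤m))))
        (window-recurrence m ⌊ m ∸ (2 + h) /2⌋ (suc h))
... | no 2+h≰m = begin
  leftFactorCount m (2 + h) + leftFactorCount m h
    ≡⟨ cong₂ _+_ (trans (leftFactorCount-window m (2 + h)) (cong (λ i → window m i (3 + h)) centre₁≡0))
                 (trans (leftFactorCount-window m h) (cong (λ i → window m i (suc h)) centre≡0)) ⟩
  window m 0 (3 + h) + window m 0 (suc h)       ≡⟨ window-recurrence₀ m (suc h) m<2+h ⟩
  window (suc m) 0 (2 + h)                      ≡⟨ cong (λ i → window (suc m) i (2 + h)) centre≡0 ⟨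
  window (suc m) ⌊ m ∸ h /2⌋ (2 + h)            ∎
  where
  open ≡-Reasoning
  m<2+h : m < 2 + h
  m<2+h = ≰⇒> 2+h≰m
  centre₁≡0 : ⌊ m ∸ (2 + h) /2⌋ ≡ 0
  centre₁≡0 = cong ⌊_/2⌋ (m≤n⇒m∸n≡0 (<⇒≤ m<2+h))
  centre≡0 : ⌊ m ∸ h /2⌋ ≡ 0
  centre≡0 = ⌊∸/2⌋≡0 m h (≤-pred m<2+h)

⌊n/2⌋≡n/2 : ∀ n → ⌊ n /2⌋ ≡ n / 2
⌊n/2⌋≡n/2 zero          = refl
⌊n/2⌋≡n/2 (suc zero)    = refl
⌊n/2⌋≡n/2 (suc (suc n)) =
  trans (cong suc (⌊n/2⌋≡n/2 n)) (sym (m/n≡1+[m∸n]/n {suc (suc n)} {2} (s≤s (s≤s z≤n))))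

leftFactorCount-central : ∀ m → leftFactorCount m 0 ≡ m C (m / 2)
leftFactorCount-central m = trans (leftFactorCount-window m 0) (trans (+-identityʳ _) (cong (m C_) (⌊n/2⌋≡n/2 m)))

lemma3p1 : (n : ℕ) → 3 ≤ n →
    (𝒫 n ⤖ ℒ (n ∸ 1)) × (𝒫 n ⤖ Fin ((n ∸ 1) C ((n ∸ 1) / 2)))
lemma3p1 (suc m) _ =
  ↔⇒⤖ (↔-sym (ℒ↔LeftFactors m) ↔-∘ 𝒫↔LeftFactors m) ,
  ↔⇒⤖ (subst (λ c → 𝒫 (suc m) ↔ Fin c) (leftFactorCount-central m) (LeftFactors↔Fin m 0 ↔-∘ 𝒫↔LeftFactors m))
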